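{- Let $d\ge 4$ and $\ell\ge 4$ be integers. The diameter of the cyclic Kautz digraph $CK(d,\ell)$ is $2\ell-2$.
   Context: $CK(d,\ell)$ is the digraph whose vertices are the words $x_1x_2\ldots x_\ell$ over $\mathbb{Z}_{d+1}$ with $x_i\neq x_{i+1}$ for $i=1,\dots,\ell-1$ and $x_\ell\neq x_1$, with arcs $x_1x_2\ldots x_\ell\to x_2\ldots x_\ell y$ for every $y\in\mathbb{Z}_{d+1}$ with $y\neq x_2,x_\ell$. The diameter is the maximum over ordered pairs of vertices of the directed distance. -}

module Defs where

open import Data.Nat using (ℕ; zero; suc; _≤_; _+_)
open import Data.Fin using (Fin)
open import Data.List using (List; []; _∷_; _++_; [_]; length; head; last)
open import Data.List.Relation.Unary.Linked using (Linked)
open import Data.Maybe using (Maybe; just)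
open import Data.Product using (Σ; ∃; _×_; Σ-syntax)
open import Data.Unit using (⊤)
open import Relation.Binary.PropositionalEquality using (_≡_; _≢_)

Word : ℕ → Set
Word d = List (Fin (suc d))

CyclicEnds : {A : Set} → List A → Set
CyclicEnds []       = ⊤
CyclicEnds (x ∷ xs) = last (x ∷ xs) ≢ just x

IsVertex : (d ℓ : ℕ) → Word d → Set
IsVertex d ℓ w = (length w ≡ ℓ) × Linked _≢_ w × CyclicEnds w

Vertex : ℕ → ℕ → Set
Vertex d ℓ = Σ (Word d) (IsVertex d ℓ)

Arc : {d : ℕ} → Word d → Word d → Set
Arc {d} x z =
  Σ[ a ∈ Fin (suc d) ] Σ[ w ∈ Word d ] Σ[ y ∈ Fin (suc d) ]
    (x ≡ a ∷ w) × (z ≡ w ++ [ y ]) × (head w ≢ just y) × (last x ≢ just y)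

data Walk {d ℓ : ℕ} : Vertex d ℓ → Vertex d ℓ → ℕ → Set where
  here  : ∀ {u} → Walk u u 0
  step  : ∀ {u v w k} → Arc (Σ.proj₁ u) (Σ.proj₁ v) → Walk v w k → Walk u w (suc k)

DistLe : {d ℓ : ℕ} → Vertex d ℓ → Vertex d ℓ → ℕ → Set
DistLe u v D = ∃ λ k → k ≤ D × Walk u v k

HasDiameter : (d ℓ : ℕ) → ℕ → Set
HasDiameter d ℓ D =
  ((u v : Vertex d ℓ) → DistLe u v D) ×
  (Σ[ u ∈ Vertex d ℓ ] Σ[ v ∈ Vertex d ℓ ] ((k : ℕ) → Walk u v k → D ≤ k))

module Submission where

-- A walk of length k from u writes the word u y₁ … y_k whose last ℓ letters form the endpoint,
-- and the arcs are exactly the appends where each new letter differs from its predecessor and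
-- from the letter ℓ - 1 places back.
-- Upper bound: with d + 1 ≥ 5 letters one can greedily write a bridge m between u and v, each
-- letter avoiding at most four others, of length ℓ - 2 (ℓ - 3 when u ends with the letter v
-- starts with), and then write v itself: at most 2ℓ - 2 arcs.
-- Lower bound: for u = s₀s₁s₀s₁…s₂ and v = s₀ followed by s₂ and s₁ alternating with a
-- suitable phase, placing v at any offset k < 2ℓ - 2 after the start of u makes, by parity,
-- either an overlapping letter of u and v disagree or a new letter repeat the one ℓ - 1 back.

open import Defs
open import Data.Nat
  using (ℕ; zero; suc; _+_; _*_; _∸_; _≤_; _<_; z≤n; s≤s; parity; compare; less; equal; greater)
open import Data.Nat.Properties
  using ( suc-injective; +-suc; +-comm; +-assoc; +-cancelˡ-≤; +-monoˡ-≤; m≤n⇒∃[o]m+o≡n; m≤n⇒m≤1+n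
        ; m≤m+n; m≤n+m; n≤1+n; ≤-refl; ≤-trans; ≤-reflexive; ≰⇒>; _≤?_; module ≤-Reasoning)
open import Data.Nat.Tactic.RingSolver using (solve-∀)
open import Data.Parity.Base as ℙ using (Parity; 0ℙ; 1ℙ; _⁻¹)
open import Data.Parity.Properties
  using (suc-homo-⁻¹; ⁻¹-selfInverse; +-homo-+; p+p≡0ℙ) renaming (+-identityʳ to ℙ-+-identityʳ)
open import Data.Fin using (Fin) renaming (zero to fzero; suc to fsuc)
open import Data.Fin.Properties using (_≟_; any?; pigeonhole; <⇒≢)
open import Data.List
  using (List; []; _∷_; _++_; _∷ʳ_; length; head; last; drop; applyUpTo; lookup; initLast; _∷ʳ′_)
open import Data.List.Properties
  using (length-++; ++-identityʳ; ++-assoc; ∷ʳ-++; drop-drop; length-applyUpTo; applyUpTo-∷ʳ)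
open import Data.List.Relation.Unary.Linked as Linked using (Linked; []; [-]; _∷_)
open import Data.List.Relation.Unary.Linked.Properties using (applyUpTo⁺₂) renaming (++⁺ to Linked-++⁺)
open import Data.List.Relation.Unary.All using (All; []; _∷_)
open import Data.List.Relation.Unary.All.Properties using (¬Any⇒All¬)
open import Data.List.Relation.Unary.Any as Any using (index)
open import Data.List.Relation.Unary.Any.Properties using (lookup-index)
open import Data.List.Membership.Propositional using (_∈_)
open import Data.List.Relation.Binary.Pointwise using (Pointwise; []; _∷_)
open import Data.List.Relation.Binary.Pointwise.Properties using (Pointwise-length)
open import Data.List.Relation.Binary.Prefix.Heterogeneous using (Prefix; []; _∷_)
open import Data.List.Relation.Binary.Prefix.Heterogeneous.Properties using (++⁺)
open import Data.Maybe using (Maybe; just)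
open import Data.Maybe.Properties using (just-injective)
open import Data.Maybe.Relation.Binary.Connected using (Connected; just)
open import Data.Product using (∃; _×_; _,_; proj₁; proj₂; Σ-syntax)
open import Data.Empty using (⊥-elim)
open import Function using (_∘_)
open import Relation.Nullary using (¬_; yes; no; contradiction)
open import Relation.Nullary.Decidable using (¬?; decidable-stable)
open import Relation.Binary.PropositionalEquality
  using (_≡_; _≢_; refl; sym; trans; cong; cong₂; subst; ≢-sym; module ≡-Reasoning)

module _ {A : Set} where

  _!_ : List A → ℕ → Maybe A
  xs ! i = head (drop i xs)

  length-∷ʳ : ∀ (xs : List A) x → length (xs ∷ʳ x) ≡ suc (length xs)
  length-∷ʳ xs x = trans (length-++ xs) (+-comm (length xs) 1)

  length-∷ʳ⁻ : ∀ (xs : List A) x {n} → length (xs ∷ʳ x) ≡ suc n → length xs ≡ n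
  length-∷ʳ⁻ xs x eq = suc-injective (trans (sym (length-∷ʳ xs x)) eq)

  last-∷ʳ : ∀ (xs : List A) x → last (xs ∷ʳ x) ≡ just x
  last-∷ʳ []           x = refl
  last-∷ʳ (y ∷ [])     x = refl
  last-∷ʳ (y ∷ z ∷ xs) x = last-∷ʳ (z ∷ xs) x

  last-applyUpTo : ∀ (f : ℕ → A) n → last (applyUpTo f (suc n)) ≡ just (f n)
  last-applyUpTo f n = trans (cong last (sym (applyUpTo-∷ʳ f n))) (last-∷ʳ (applyUpTo f n) (f n))

  drop-length-++ : ∀ (xs ys : List A) → drop (length xs) (xs ++ ys) ≡ ys
  drop-length-++ []       ys = refl
  drop-length-++ (x ∷ xs) ys = drop-length-++ xs ys

  drop-length-++-++ : ∀ (xs ys zs : List A) → length xs ≡ length zs →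
                      drop (length (ys ++ zs)) (xs ++ ys ++ zs) ≡ zs
  drop-length-++-++ xs ys zs eq = begin
    drop (length (ys ++ zs)) (xs ++ ys ++ zs)   ≡⟨ cong₂ drop same-length (sym (++-assoc xs ys zs)) ⟩
    drop (length (xs ++ ys)) ((xs ++ ys) ++ zs) ≡⟨ drop-length-++ (xs ++ ys) zs ⟩
    zs                                          ∎
    where
      open ≡-Reasoning
      same-length : length (ys ++ zs) ≡ length (xs ++ ys)
      same-length = begin
        length (ys ++ zs)        ≡⟨ length-++ ys ⟩
        length ys + length zs    ≡⟨ +-comm (length ys) (length zs) ⟩
        length zs + length ys    ≡⟨ cong (_+ length ys) (sym eq) ⟩
        length xs + length ys    ≡⟨ sym (length-++ xs) ⟩
        length (xs ++ ys)        ∎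

  !-drop : ∀ k (xs : List A) i → drop k xs ! i ≡ xs ! (k + i)
  !-drop k xs i = cong head (drop-drop k i xs)

  !-++ˡ : ∀ (xs ys : List A) {i} → i < length xs → (xs ++ ys) ! i ≡ xs ! i
  !-++ˡ (x ∷ xs) ys {zero}  _         = refl
  !-++ˡ (x ∷ xs) ys {suc i} (s≤s i<n) = !-++ˡ xs ys i<n

  !-++ʳ : ∀ (xs ys : List A) {n} → length xs ≡ n → ∀ i → (xs ++ ys) ! (n + i) ≡ ys ! i
  !-++ʳ xs ys refl i = trans (sym (!-drop (length xs) (xs ++ ys) i)) (cong (_! i) (drop-length-++ xs ys))

  !-applyUpTo : ∀ (f : ℕ → A) {n i} → i < n → applyUpTo f n ! i ≡ just (f i)
  !-applyUpTo f {suc n} {zero}  _         = refl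
  !-applyUpTo f {suc n} {suc i} (s≤s i<n) = !-applyUpTo (f ∘ suc) i<n

  Prefix-≢-! : ∀ {xs ys : List A} {i} → Prefix _≢_ xs ys → i < length xs → xs ! i ≢ ys ! i
  Prefix-≢-! {i = zero}  (x≢y ∷ _) _         = x≢y ∘ just-injective
  Prefix-≢-! {i = suc i} (_ ∷ xs≢ys) (s≤s i<n) = Prefix-≢-! xs≢ys i<n

  Prefix-splice : ∀ {m p s t q : List A} {b e} →
                  Pointwise _≢_ m p → Pointwise _≢_ (b ∷ t) s → Pointwise _≢_ q m → e ≢ b →
                  Prefix _≢_ (m ++ (b ∷ t) ++ q ∷ʳ e) (p ++ s ++ m ++ (b ∷ t) ++ q ∷ʳ e)
  Prefix-splice m≢p bt≢s q≢m e≢b = ++⁺ m≢p (++⁺ bt≢s (++⁺ q≢m (e≢b ∷ [])))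

  Linked-++⁻ˡ : ∀ {R : A → A → Set} xs {ys} → Linked R (xs ++ ys) → Linked R xs
  Linked-++⁻ˡ []            _       = []
  Linked-++⁻ˡ (x ∷ [])      _       = [-]
  Linked-++⁻ˡ (x ∷ x′ ∷ xs) (r ∷ l) = r ∷ Linked-++⁻ˡ (x′ ∷ xs) l

  Linked-glue : ∀ {R : A → A → Set} xs {y ys} →
                Linked R (xs ∷ʳ y) → Linked R (y ∷ ys) → Linked R (xs ++ y ∷ ys)
  Linked-glue []            _       r = r
  Linked-glue (x ∷ [])      (r ∷ _) l = r ∷ l
  Linked-glue (x ∷ x′ ∷ xs) (r ∷ k) l = r ∷ Linked-glue (x′ ∷ xs) k l

  last-≢ : ∀ (x : A) xs {y ys} → Linked _≢_ (x ∷ xs ++ y ∷ ys) → last (x ∷ xs) ≢ just y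
  last-≢ x []        (x≢y ∷ _) = x≢y ∘ just-injective
  last-≢ x (x′ ∷ xs) (_ ∷ l)   = last-≢ x′ xs l

  CyclicEnds-∷ʳ⁻ : ∀ b q e → CyclicEnds (b ∷ q ∷ʳ e) → e ≢ b
  CyclicEnds-∷ʳ⁻ b q e cyclic e≡b = cyclic (trans (last-∷ʳ (b ∷ q) e) (cong just e≡b))

fresh : ∀ {n} (xs : List (Fin n)) → length xs < n → ∃ λ y → All (y ≢_) xs
fresh xs short with any? (λ y → ¬? (Any.any? (y ≟_) xs))
... | yes (y , y∉xs) = y , ¬Any⇒All¬ xs y∉xs
... | no ¬fresh =
  let i , j , i<j , same = pigeonhole short (index ∘ ∈xs)
  in contradiction (trans (lookup-index (∈xs i)) (trans (cong (lookup xs) same) (sym (lookup-index (∈xs j)))))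
                   (<⇒≢ i<j)
  where
    ∈xs : ∀ y → y ∈ xs
    ∈xs y = decidable-stable (Any.any? (y ≟_) xs) (λ y∉xs → ¬fresh (y , y∉xs))

2[1+n]∸2≡n+n : ∀ n → 2 * suc n ∸ 2 ≡ n + n
2[1+n]∸2≡n+n n = cong (_∸ 2) (double n)
  where
    double : ∀ n → 2 * suc n ≡ 2 + (n + n)
    double = solve-∀

1+m+n<m+m⇒2+n≤m : ∀ m n → suc (m + n) < m + m → suc (suc n) ≤ m
1+m+n<m+m⇒2+n≤m m n lt = +-cancelˡ-≤ m (suc (suc n)) m (subst (_≤ m + m) (rearrange m n) lt)
  where
    rearrange : ∀ m n → suc (suc (m + n)) ≡ m + suc (suc n)
    rearrange = solve-∀

walk-length-bound : ∀ {n ℓ} → n ≤ ℓ → n + suc (suc ℓ) ≤ 2 * suc (suc ℓ) ∸ 2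
walk-length-bound {n} {ℓ} n≤ℓ = begin
  n + suc (suc ℓ)      ≤⟨ +-monoˡ-≤ (suc (suc ℓ)) n≤ℓ ⟩
  ℓ + suc (suc ℓ)      ≡⟨ +-suc ℓ (suc ℓ) ⟩
  suc ℓ + suc ℓ        ≡⟨ sym (2[1+n]∸2≡n+n (suc ℓ)) ⟩
  2 * suc (suc ℓ) ∸ 2  ∎
  where open ≤-Reasoning

byParity : {A : Set} → A → A → Parity → A
byParity even odd 0ℙ = even
byParity even odd 1ℙ = odd

parity-suc : ∀ n → parity (suc n) ≡ parity n ⁻¹
parity-suc n = sym (⁻¹-selfInverse (suc-homo-⁻¹ n))

parity-+-double : ∀ m n → parity (m + (n + n)) ≡ parity m
parity-+-double m n = begin
  parity (m + (n + n))            ≡⟨ +-homo-+ m (n + n) ⟩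
  parity m ℙ.+ parity (n + n)     ≡⟨ cong (parity m ℙ.+_) (trans (+-homo-+ n n) (p+p≡0ℙ (parity n))) ⟩
  parity m ℙ.+ 0ℙ                 ≡⟨ ℙ-+-identityʳ (parity m) ⟩
  parity m                        ∎
  where open ≡-Reasoning

module _ {A : Set} {a b : A} where

  byParity-alternates : a ≢ b → ∀ n → byParity a b (parity n) ≢ byParity a b (parity (suc n))
  byParity-alternates a≢b n rewrite parity-suc n with parity n
  ... | 0ℙ = a≢b
  ... | 1ℙ = ≢-sym a≢b

  byParity-≢ : ∀ {c} → a ≢ c → b ≢ c → ∀ p → byParity a b p ≢ c
  byParity-≢ a≢c b≢c 0ℙ = a≢c
  byParity-≢ a≢c b≢c 1ℙ = b≢c

-- Walks as admissible extensions

-- The i-th appended letter is compared with the letter of x ++ ys at position i + 1,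
-- which lies |x| - 1 places before it.
Admissible : {A : Set} → List A → List A → Set
Admissible x ys = Linked _≢_ (x ++ ys) × Prefix _≢_ ys (drop 1 x ++ ys)

module _ {d ℓ : ℕ} where

  arc : ∀ {a b : Fin (suc d)} {w y ys z} → Linked _≢_ (a ∷ b ∷ w ++ y ∷ ys) → y ≢ b →
        z ≡ b ∷ w ∷ʳ y → Arc (a ∷ b ∷ w) z
  arc {a} {b} {w} {y} linked y≢b z≡ =
    a , b ∷ w , y , refl , z≡ , y≢b ∘ sym ∘ just-injective , last-≢ a (b ∷ w) linked

  extension⇒walk : (u v : Vertex d ℓ) (y : Fin (suc d)) (ys : Word d) →
                   Admissible (proj₁ u) (y ∷ ys) →
                   drop (length (y ∷ ys)) (proj₁ u ++ y ∷ ys) ≡ proj₁ v → Walk u v (length (y ∷ ys))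
  extension⇒walk ([] , _)        v y ys (_ , y≢y ∷ _) _ = ⊥-elim (y≢y refl)
  extension⇒walk (a ∷ [] , _)    v y ys (_ , y≢y ∷ _) _ = ⊥-elim (y≢y refl)
  extension⇒walk (a ∷ b ∷ w , _) v y [] (linked , y≢b ∷ _) reach = step (arc linked y≢b (sym reach)) here
  extension⇒walk (a ∷ b ∷ w , len , _) v y (y′ ∷ ys) (linked , y≢b ∷ apart) reach =
    step {v = u′} (arc linked y≢b refl) (extension⇒walk u′ v y′ ys (linked′ , apart′) reach′)
    where
      linked′ : Linked _≢_ ((b ∷ w ∷ʳ y) ++ y′ ∷ ys)
      linked′ = subst (Linked _≢_) (sym (∷ʳ-++ (b ∷ w) y (y′ ∷ ys))) (Linked.tail linked)
      u′ : Vertex d ℓ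
      u′ = b ∷ w ∷ʳ y
         , trans (length-∷ʳ (b ∷ w) y) len
         , Linked-++⁻ˡ (b ∷ w ∷ʳ y) linked′
         , λ last≡b → y≢b (just-injective (trans (sym (last-∷ʳ (b ∷ w) y)) last≡b))
      apart′ : Prefix _≢_ (y′ ∷ ys) ((w ∷ʳ y) ++ y′ ∷ ys)
      apart′ = subst (Prefix _≢_ (y′ ∷ ys)) (sym (∷ʳ-++ w y (y′ ∷ ys))) apart
      reach′ : drop (length (y′ ∷ ys)) ((b ∷ w ∷ʳ y) ++ y′ ∷ ys) ≡ proj₁ v
      reach′ = trans (cong (drop (length (y′ ∷ ys))) (∷ʳ-++ (b ∷ w) y (y′ ∷ ys))) reach

module _ {d ℓ : ℕ} where

  walk⇒extension : ∀ {u v : Vertex d (suc (suc ℓ))} {k} → Walk u v k →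
                   Σ[ ys ∈ Word d ] length ys ≡ k × drop k (proj₁ u ++ ys) ≡ proj₁ v
                                    × Prefix _≢_ ys (drop 1 (proj₁ u) ++ ys)
  walk⇒extension {u} here = [] , refl , ++-identityʳ (proj₁ u) , []
  walk⇒extension (step {u = _ , () , _} (a , [] , y , refl , refl , _) _)
  walk⇒extension (step (a , b ∷ w , y , refl , refl , b≢y , _) walk) with walk⇒extension walk
  ... | ys , refl , reach , apart =
    y ∷ ys , refl , trans (cong (drop (length ys)) (sym (∷ʳ-++ (b ∷ w) y ys))) reach
           , (λ y≡b → b≢y (cong just (sym y≡b))) ∷ subst (Prefix _≢_ ys) (∷ʳ-++ w y ys) apart

  walk-via : (u v : Vertex d (suc (suc ℓ))) (m : Word d) {n : ℕ} → length m ≡ suc n →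
             Admissible (proj₁ u) (m ++ proj₁ v) → Walk u v (suc n + suc (suc ℓ))
  walk-via u@(uw , ulen , _) v@(vw , vlen , _) (c ∷ m) refl admissible =
    subst (Walk u v) (trans (length-++ (c ∷ m)) (cong (length (c ∷ m) +_) vlen))
      (extension⇒walk u v c (m ++ vw) admissible
        (drop-length-++-++ uw (c ∷ m) vw (trans ulen (sym vlen))))

-- Distances are at most 2ℓ - 2

module _ {d : ℕ} (4≤d : 4 ≤ d) where

  bridge : (z b x y : Fin (suc d)) (p q : Word d) → length p ≡ length q →
           Σ[ m ∈ Word d ] Linked _≢_ (z ∷ m ∷ʳ b)
                         × Pointwise _≢_ m (x ∷ p) × Pointwise _≢_ (y ∷ q) m
  bridge z b x y [] [] _ with fresh (z ∷ x ∷ y ∷ b ∷ []) (s≤s 4≤d)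
  ... | c , c≢z ∷ c≢x ∷ c≢y ∷ c≢b ∷ [] =
    c ∷ [] , ≢-sym c≢z ∷ c≢b ∷ [-] , c≢x ∷ [] , ≢-sym c≢y ∷ []
  bridge z b x y (x′ ∷ p) (y′ ∷ q) eq = prepend (fresh (z ∷ x ∷ y ∷ []) (m≤n⇒m≤1+n 4≤d))
    where
      prepend : ∃ (λ c → All (c ≢_) (z ∷ x ∷ y ∷ [])) →
                Σ[ m ∈ Word d ] Linked _≢_ (z ∷ m ∷ʳ b)
                              × Pointwise _≢_ m (x ∷ x′ ∷ p) × Pointwise _≢_ (y ∷ y′ ∷ q) m
      prepend (c , c≢z ∷ c≢x ∷ c≢y ∷ []) =
        let m , linked , m≢p , q≢m = bridge c b x′ y′ p q (suc-injective eq)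
        in c ∷ m , ≢-sym c≢z ∷ linked , c≢x ∷ m≢p , ≢-sym c≢y ∷ q≢m

  splice-≢ : ∀ {n} a {z b} e (p q : Word d) → z ≢ b → length p ≡ suc n → length q ≡ suc n →
             Linked _≢_ (a ∷ p ∷ʳ z) → Linked _≢_ (b ∷ q ∷ʳ e) → e ≢ b →
             Σ[ m ∈ Word d ] length m ≡ suc n × Admissible (a ∷ p ∷ʳ z) (m ++ b ∷ q ∷ʳ e)
  splice-≢ a {z} {b} e (x ∷ p) (y ∷ q) z≢b lp lq linked-u linked-v e≢b =
    let m , mid , m≢p , q≢m = bridge z b x y p q (suc-injective (trans lp (sym lq)))
        v = b ∷ (y ∷ q) ∷ʳ e
    in m , trans (Pointwise-length m≢p) lp
         , subst (Linked _≢_) (sym (∷ʳ-++ (a ∷ x ∷ p) z (m ++ v)))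
                 (Linked-glue (a ∷ x ∷ p) linked-u (Linked-glue (z ∷ m) mid linked-v))
         , subst (Prefix _≢_ (m ++ v)) (sym (∷ʳ-++ (x ∷ p) z (m ++ v)))
                 (Prefix-splice m≢p (≢-sym z≢b ∷ []) q≢m e≢b)

  splice-≡ : ∀ {n} a {y′ b c} e (p q : Word d) → length p ≡ suc n → length q ≡ suc n →
             Linked _≢_ (a ∷ p ∷ʳ y′ ∷ʳ b) → Linked _≢_ (b ∷ c ∷ q ∷ʳ e) → e ≢ b →
             Σ[ m ∈ Word d ] length m ≡ suc n × Admissible (a ∷ p ∷ʳ y′ ∷ʳ b) (m ++ b ∷ c ∷ q ∷ʳ e)
  splice-≡ a {y′} {b} {c} e (x ∷ p) (y ∷ q) lp lq linked-u linked-v e≢b =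
    let m , mid , m≢p , q≢m = bridge b b x y p q (suc-injective (trans lp (sym lq)))
        v = b ∷ c ∷ (y ∷ q) ∷ʳ e
        y′≢b : y′ ≢ b
        y′≢b y′≡b = last-≢ a ((x ∷ p) ∷ʳ y′) linked-u
                      (trans (last-∷ʳ (a ∷ x ∷ p) y′) (cong just y′≡b))
    in m , trans (Pointwise-length m≢p) lp
         , subst (Linked _≢_) (sym (∷ʳ-++ (a ∷ (x ∷ p) ∷ʳ y′) b (m ++ v)))
                 (Linked-glue (a ∷ (x ∷ p) ∷ʳ y′) linked-u (Linked-glue (b ∷ m) mid linked-v))
         , subst (Prefix _≢_ (m ++ v))
                 (sym (trans (∷ʳ-++ ((x ∷ p) ∷ʳ y′) b (m ++ v)) (∷ʳ-++ (x ∷ p) y′ (b ∷ m ++ v))))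
                 (Prefix-splice m≢p (≢-sym y′≢b ∷ ≢-sym (Linked.head linked-v) ∷ []) q≢m e≢b)

  distance-≤ : ∀ {ℓ} → 4 ≤ ℓ → (u v : Vertex d ℓ) → DistLe u v (2 * ℓ ∸ 2)
  distance-≤ (s≤s (s≤s (s≤s (s≤s {n = ℓ₄} _))))
             (a ∷ w , ulen , linked-u , cyclic-u) (b ∷ r , vlen , linked-v , cyclic-v)
    with initLast w | initLast r
  ... | [] | _ = contradiction ulen λ ()
  ... | _ | [] = contradiction vlen λ ()
  ... | p ∷ʳ′ z | q ∷ʳ′ e with z ≟ b
  ...   | no z≢b =
    let m , lm , admissible =
          splice-≢ a e p q z≢b (length-∷ʳ⁻ p z (suc-injective ulen)) (length-∷ʳ⁻ q e (suc-injective vlen))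
                   linked-u linked-v (CyclicEnds-∷ʳ⁻ b q e cyclic-v)
    in _ , walk-length-bound {ℓ = suc (suc ℓ₄)} ≤-refl
         , walk-via (_ , ulen , linked-u , cyclic-u) (_ , vlen , linked-v , cyclic-v) m lm admissible
  ...   | yes refl with initLast p | q
  ...     | [] | _ = contradiction ulen λ ()
  ...     | _ | [] = contradiction vlen λ ()
  ...     | p′ ∷ʳ′ y′ | c ∷ q′ =
    let m , lm , admissible =
          splice-≡ a e p′ q′ (length-∷ʳ⁻ p′ y′ (length-∷ʳ⁻ (p′ ∷ʳ y′) b (suc-injective ulen)))
                   (length-∷ʳ⁻ q′ e (suc-injective (suc-injective vlen)))
                   linked-u linked-v (CyclicEnds-∷ʳ⁻ b (c ∷ q′) e cyclic-v)
    in _ , walk-length-bound {ℓ = suc (suc ℓ₄)} (n≤1+n _)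
         , walk-via (_ , ulen , linked-u , cyclic-u) (_ , vlen , linked-v , cyclic-v) m lm admissible

-- A pair at distance 2ℓ - 2

module _ {A : Set} {s₀ s₁ s₂ : A} where

  -- What a walk of length k from AlternatingPair.source to AlternatingPair.target forces on
  -- its letter sequence S; apart is the arc condition on the letters appended after the source.
  record WalkLetters (ℓ₁ k : ℕ) (S : List A) : Set where
    field
      source       : ∀ i → i < ℓ₁ → S ! i ≡ just (byParity s₀ s₁ (parity i))
      source-end   : S ! ℓ₁ ≡ just s₂
      target-start : S ! k ≡ just s₀
      target       : ∀ j → j < ℓ₁ → S ! (k + suc j) ≡ just (byParity s₂ s₁ (parity (j + ℓ₁)))
      apart        : ∀ τ → τ < k → S ! (suc ℓ₁ + τ) ≢ S ! suc τ

  module _ (s₀≢s₁ : s₀ ≢ s₁) (s₁≢s₂ : s₁ ≢ s₂) (s₀≢s₂ : s₀ ≢ s₂) where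

    no-overlap : ∀ k r {S} → ¬ WalkLetters (suc (k + r)) k S
    no-overlap k r {S} letters with parity k in parity-k
    ... | 1ℙ = s₀≢s₁ (just-injective (begin
      just s₀                              ≡⟨ sym target-start ⟩
      S ! k                                ≡⟨ source k (s≤s (m≤m+n k r)) ⟩
      just (byParity s₀ s₁ (parity k))     ≡⟨ cong (just ∘ byParity s₀ s₁) parity-k ⟩
      just s₁                              ∎))
      where
        open WalkLetters letters
        open ≡-Reasoning
    ... | 0ℙ = s₁≢s₂ (just-injective (begin
      just s₁                                            ≡⟨ cong (just ∘ byParity s₂ s₁) (sym odd) ⟩
      just (byParity s₂ s₁ (parity (r + suc (k + r))))   ≡⟨ sym (target r (s≤s (m≤n+m r k))) ⟩
      S ! (k + suc r)                                    ≡⟨ cong (S !_) (+-suc k r) ⟩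
      S ! suc (k + r)                                    ≡⟨ source-end ⟩
      just s₂                                            ∎))
      where
        open WalkLetters letters
        open ≡-Reasoning
        rearrange : ∀ k r → r + suc (k + r) ≡ suc k + (r + r)
        rearrange = solve-∀
        odd : parity (r + suc (k + r)) ≡ 1ℙ
        odd = trans (cong parity (rearrange k r))
                    (trans (parity-+-double (suc k) r) (trans (parity-suc k) (cong _⁻¹ parity-k)))

    no-short-gap : ∀ t r {S} → ¬ WalkLetters (suc (suc (t + r))) (suc (suc (suc (t + r)) + t)) S
    no-short-gap t r {S} letters with parity t in parity-t
    ... | 1ℙ = apart t (s≤s (m≤n+m t _)) (begin
      S ! (suc (suc (suc (t + r))) + t)     ≡⟨ target-start ⟩
      just s₀                               ≡⟨ cong (just ∘ byParity s₀ s₁) (sym even) ⟩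
      just (byParity s₀ s₁ (parity (suc t))) ≡⟨ sym (source (suc t) (s≤s (s≤s (m≤m+n t r)))) ⟩
      S ! suc t                             ∎)
      where
        open WalkLetters letters
        open ≡-Reasoning
        even : parity (suc t) ≡ 0ℙ
        even = trans (parity-suc t) (cong _⁻¹ parity-t)
    ... | 0ℙ = apart (t + suc r) τ<k (begin
      S ! (suc ℓ₁ + (t + suc r))                   ≡⟨ cong (λ i → S ! suc i) (sym (+-assoc ℓ₁ t (suc r))) ⟩
      S ! (suc (ℓ₁ + t) + suc r)                   ≡⟨ target r (s≤s (≤-trans (m≤n+m r t) (n≤1+n _))) ⟩
      just (byParity s₂ s₁ (parity (r + ℓ₁)))      ≡⟨ cong (just ∘ byParity s₂ s₁) even ⟩
      just s₂                                      ≡⟨ sym source-end ⟩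
      S ! ℓ₁                                       ≡⟨ cong (λ i → S ! suc i) (sym (+-suc t r)) ⟩
      S ! suc (t + suc r)                          ∎)
      where
        open WalkLetters letters
        open ≡-Reasoning
        ℓ₁ = suc (suc (t + r))
        rearrange : ∀ t r → r + suc (suc (t + r)) ≡ t + (suc r + suc r)
        rearrange = solve-∀
        even : parity (r + ℓ₁) ≡ 0ℙ
        even = trans (cong parity (rearrange t r)) (trans (parity-+-double t (suc r)) parity-t)
        τ<k : t + suc r < suc (ℓ₁ + t)
        τ<k = s≤s (≤-trans (≤-reflexive (+-suc t r)) (≤-trans (n≤1+n _) (m≤m+n _ t)))

    WalkLetters-≥ : ∀ ℓ₁ k {S} → WalkLetters ℓ₁ k S → ℓ₁ + ℓ₁ ≤ k
    WalkLetters-≥ ℓ₁ k letters with ℓ₁ + ℓ₁ ≤? k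
    ... | yes long = long
    ... | no short with compare k ℓ₁
    ...   | less _ r = contradiction letters (no-overlap k r)
    ...   | equal _ = contradiction (trans (sym target-start) source-end) (s₀≢s₂ ∘ just-injective)
      where open WalkLetters letters
    ...   | greater _ t with m≤n⇒∃[o]m+o≡n (1+m+n<m+m⇒2+n≤m ℓ₁ t (≰⇒> short))
    ...     | r , refl = contradiction letters (no-short-gap t r)

module AlternatingPair (d ℓ₂ : ℕ) where

  ℓ₁ : ℕ
  ℓ₁ = suc ℓ₂

  s₀ s₁ s₂ : Fin (3 + d)
  s₀ = fzero
  s₁ = fsuc fzero
  s₂ = fsuc (fsuc fzero)

  src tgt : ℕ → Fin (3 + d)
  src i = byParity s₀ s₁ (parity i)
  tgt j = byParity s₂ s₁ (parity (j + ℓ₁))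

  source target : Vertex (2 + d) (suc ℓ₁)
  source = applyUpTo src ℓ₁ ∷ʳ s₂
         , trans (length-∷ʳ (applyUpTo src ℓ₁) s₂) (cong suc (length-applyUpTo src ℓ₁))
         , Linked-++⁺ (applyUpTo⁺₂ src ℓ₁ (byParity-alternates {a = s₀} {s₁} (λ ())))
                      (subst (λ x → Connected _≢_ x (just s₂)) (sym (last-applyUpTo src ℓ₂))
                             (just (byParity-≢ {a = s₀} {s₁} (λ ()) (λ ()) (parity ℓ₂))))
                      [-]
         , λ last≡s₀ → contradiction (just-injective (trans (sym (last-∷ʳ (applyUpTo src ℓ₁) s₂)) last≡s₀))
                                     λ ()
  target = s₀ ∷ applyUpTo tgt ℓ₁
         , cong suc (length-applyUpTo tgt ℓ₁)
         , ≢-sym (byParity-≢ {a = s₂} {s₁} (λ ()) (λ ()) (parity ℓ₁))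
           ∷ applyUpTo⁺₂ tgt ℓ₁ (λ j → byParity-alternates {a = s₂} {s₁} (λ ()) (j + ℓ₁))
         , λ last≡s₀ → byParity-≢ {a = s₂} {s₁} (λ ()) (λ ()) (parity (ℓ₂ + ℓ₁))
                          (just-injective (trans (sym (last-applyUpTo tgt ℓ₂)) last≡s₀))

  walk-letters : ∀ {k} → Walk source target k →
                 Σ[ S ∈ Word (2 + d) ] WalkLetters {s₀ = s₀} {s₁} {s₂} ℓ₁ k S
  walk-letters {k} walk = u ++ ys , record
    { source       = λ i i<ℓ₁ → begin
        (u ++ ys) ! i                     ≡⟨ cong (_! i) (∷ʳ-++ (applyUpTo src ℓ₁) s₂ ys) ⟩
        (applyUpTo src ℓ₁ ++ s₂ ∷ ys) ! i ≡⟨ !-++ˡ (applyUpTo src ℓ₁) (s₂ ∷ ys)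
                                                     (subst (i <_) (sym (length-applyUpTo src ℓ₁)) i<ℓ₁) ⟩
        applyUpTo src ℓ₁ ! i              ≡⟨ !-applyUpTo src i<ℓ₁ ⟩
        just (src i)                      ∎
    ; source-end   = trans (cong₂ _!_ (∷ʳ-++ (applyUpTo src ℓ₁) s₂ ys) (sym (length-applyUpTo src ℓ₁)))
                           (cong head (drop-length-++ (applyUpTo src ℓ₁) (s₂ ∷ ys)))
    ; target-start = cong head reach
    ; target       = λ j j<ℓ₁ → begin
        (u ++ ys) ! (k + suc j)           ≡⟨ sym (!-drop k (u ++ ys) (suc j)) ⟩
        drop k (u ++ ys) ! suc j          ≡⟨ cong (_! suc j) reach ⟩
        applyUpTo tgt ℓ₁ ! j              ≡⟨ !-applyUpTo tgt j<ℓ₁ ⟩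
        just (tgt j)                      ∎
    ; apart        = λ τ τ<k → subst (_≢ (u ++ ys) ! suc τ) (sym (!-++ʳ u ys (proj₁ (proj₂ source)) τ))
                                     (Prefix-≢-! apart (subst (τ <_) (sym len) τ<k))
    }
    where
      open ≡-Reasoning
      u = proj₁ source
      extension = walk⇒extension walk
      ys = proj₁ extension
      len = proj₁ (proj₂ extension)
      reach = proj₁ (proj₂ (proj₂ extension))
      apart = proj₂ (proj₂ (proj₂ extension))

farthest-pair : ∀ {d ℓ} → 2 ≤ d → 2 ≤ ℓ →
                Σ[ u ∈ Vertex d ℓ ] Σ[ v ∈ Vertex d ℓ ] ((k : ℕ) → Walk u v k → 2 * ℓ ∸ 2 ≤ k)
farthest-pair {suc (suc d)} {suc (suc ℓ₂)} (s≤s (s≤s _)) (s≤s (s≤s _)) = source , target , λ k walk →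
  subst (_≤ k) (sym (2[1+n]∸2≡n+n ℓ₁))
        (WalkLetters-≥ (λ ()) (λ ()) (λ ()) ℓ₁ k (proj₂ (walk-letters walk)))
  where
    open AlternatingPair d ℓ₂

mainTheorem4 : (d ℓ : ℕ) → 4 ≤ d → 4 ≤ ℓ → HasDiameter d ℓ (2 * ℓ ∸ 2)
mainTheorem4 d ℓ 4≤d 4≤ℓ =
  distance-≤ 4≤d 4≤ℓ , farthest-pair (≤-trans 2≤4 4≤d) (≤-trans 2≤4 4≤ℓ)
  where
    2≤4 : 2 ≤ 4
    2≤4 = s≤s (s≤s z≤n)
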